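{- For all positive integers $k$, $d\ge k$ and $\nu\ge d$: if there exists $(N,D)\in\Delta(\nu,d,k)$ with $R^*(N,D)/R(N,D)=\delta(\nu,d,k)$, then there exists a regular $(N',D')\in\Delta(\nu,d,k)$ with $R^*(N',D')/R(N',D')=\delta(\nu,d,k)$.
   Context: $\Delta(\nu,d,k)$ is the set of pairs $(N,D)$ of arrays (finite sequences of rows) with $\nu$ columns over $\{0,1\}$ such that: $N$ contains at least one all-ones row; each row of $D$ has at most $d$ non-zero coordinates; and for every choice of $k$ columns, extracting them from $N$ and from $D$ gives the same array up to the order of rows. $R^*(N,D)$ is the number of all-ones rows in $N$, $R(N,D)$ the number of rows of $D$, and $\delta(\nu,d,k)$ the maximum ratio $R^*(N,D)/R(N,D)$ over $\Delta(\nu,d,k)$. The weight of a Boolean word is its number of non-zero coordinates. An array $M$ with rows in $\{0,1\}^\nu$ is regular if for each $i\in\{0,\ldots,\nu\}$ all words of length $\nu$ and weight $i$ occur in $M$ with the same frequency; $(N,D)$ is regular if both $N$ and $D$ are regular. -}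

module Defs where

open import Data.Nat using (ℕ; zero; suc; _+_; _*_; _≤_)
open import Data.Bool using (Bool; true; false)
open import Data.Bool.Properties using () renaming (_≟_ to _≟B_)
open import Data.Fin using (Fin)
open import Data.Vec using (Vec; []; _∷_; lookup; tabulate; replicate)
open import Data.Vec.Properties using (≡-dec)
open import Data.List using (List; length; filter; map)
open import Data.List.Membership.Propositional using (_∈_)
open import Data.List.Relation.Binary.Permutation.Propositional using (_↭_)
open import Data.Product using (_×_)
open import Function.Definitions using (Injective)
open import Relation.Binary.PropositionalEquality using (_≡_)
open import Relation.Binary.Definitions using (DecidableEquality)

Word : ℕ → Set
Word ν = Vec Bool ν

Array : ℕ → Set
Array ν = List (Word ν)

_≟W_ : ∀ {ν} → DecidableEquality (Word ν)
_≟W_ = ≡-dec _≟B_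

weight : ∀ {ν} → Word ν → ℕ
weight [] = 0
weight (true ∷ w) = suc (weight w)
weight (false ∷ w) = weight w

occ : ∀ {ν} → Word ν → Array ν → ℕ
occ w M = length (filter (w ≟W_) M)

allOnes : (ν : ℕ) → Word ν
allOnes ν = replicate ν true

restrictRow : ∀ {ν k} → (Fin k → Fin ν) → Word ν → Word k
restrictRow cols row = tabulate (λ i → lookup row (cols i))

restrict : ∀ {ν k} → (Fin k → Fin ν) → Array ν → Array k
restrict cols M = map (restrictRow cols) M

InΔ : (ν d k : ℕ) → Array ν → Array ν → Set
InΔ ν d k N D =
  (allOnes ν ∈ N)
  × ((row : Word ν) → row ∈ D → weight row ≤ d)
  × ((cols : Fin k → Fin ν) → Injective _≡_ _≡_ cols →
       restrict cols N ↭ restrict cols D)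

Rstar : ∀ {ν} → Array ν → Array ν → ℕ
Rstar {ν} N D = occ (allOnes ν) N

R : ∀ {ν} → Array ν → Array ν → ℕ
R N D = length D

RegularArray : ∀ {ν} → Array ν → Set
RegularArray {ν} M = (w w' : Word ν) → weight w ≡ weight w' → occ w M ≡ occ w' M

Regular : ∀ {ν} → Array ν → Array ν → Set
Regular N D = RegularArray N × RegularArray D

-- (N , D) attains δ(ν,d,k): its ratio R*/R is ≥ that of every pair in Δ(ν,d,k)
-- (ratios compared by cross-multiplication; R > 0 on Δ since N is non-empty
--  and the k-column projections of N and D are permutations of each other)
AttainsMax : (ν d k : ℕ) → Array ν → Array ν → Set
AttainsMax ν d k N D =
  InΔ ν d k N D ×
  ((N'' D'' : Array ν) → InΔ ν d k N'' D'' →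
     Rstar N'' D'' * R N D ≤ Rstar N D * R N'' D'')

-- Symmetrise (N , D) by stacking its images under all ν! permutations of the columns. Permuting
-- columns preserves weights, fixes the all-ones word and sends k distinct columns to k distinct
-- columns, so the symmetrised pair stays in Δ(ν,d,k), and R* and R are both multiplied by ν!: the
-- ratio is unchanged. Up to the order
-- of rows, the symmetrised array is the union of the orbits of the original rows, and the orbit of
-- r contains w exactly [|r| = |w|]·|r|!·(ν − |r|)! times, which depends on w only through |w|.
module Submission where

open import Defs
open import Algebra.Properties.CommutativeSemigroup using (x∙yz≈y∙xz; xy∙z≈y∙xz)
open import Data.Bool using (true; false; if_then_else_; T)
open import Data.Bool.Properties using () renaming (_≟_ to _≟B_)
open import Data.Fin as Fin using (Fin; punchIn)
open import Data.Fin.Properties using (punchInᵢ≢i; punchIn-injective; punchOut-punchIn)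
open import Data.List using (List; []; _∷_; [_]; _++_; length; filter; map; concat; concatMap; tabulate)
open import Data.List.Properties
  using ( length-++; length-map; filter-++; map-∘; map-cong; map-tabulate; concat-map
        ; map-concatMap; concatMap-cong)
import Data.List.Properties as List
open import Data.List.Membership.Propositional using (_∈_)
open import Data.List.Membership.Propositional.Properties
  using (∈-map⁺; ∈-map⁻; ∈-++⁺ˡ; ∈-concat⁺′; ∈-concat⁻′)
open import Data.List.Relation.Unary.Any using (here)
open import Data.List.Relation.Binary.Permutation.Propositional using (_↭_; ↭-refl; ↭-prep; ↭-trans)
open import Data.List.Relation.Binary.Permutation.Propositional.Properties
  using (↭-length; ++⁺; ++⁺ˡ; shifts; filter-↭)
open import Data.Nat using (ℕ; zero; suc; pred; _+_; _∸_; _*_; _!; _≡ᵇ_; _≤_; z≤n; s≤s)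
open import Data.Nat.Properties
  using (suc-injective; m≤n⇒m≤1+n; 1+n≰n; +-∸-assoc; *-assoc; *-zeroʳ; ≡ᵇ⇒≡; *-commutativeSemigroup)
open import Data.Product using (_×_; ∃; ∃₂; _,_; proj₂)
open import Data.Vec as Vec using (Vec; []; _∷_; lookup; removeAt)
open import Data.Vec.Properties
  using (∷-injectiveˡ; ∷-injectiveʳ; lookup∘tabulate; tabulate-cong; lookup-replicate; removeAt-punchOut)
open import Function using (_∘_)
open import Function.Definitions using (Injective)
open import Relation.Nullary using (yes; no; contradiction)
open import Relation.Binary.PropositionalEquality
  using (_≡_; _≢_; refl; sym; trans; cong; cong₂; subst; subst₂; module ≡-Reasoning)

private
  variable
    k m n ν : ℕ

weight-≤ : (r : Word n) → weight r ≤ n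
weight-≤ []          = z≤n
weight-≤ (true ∷ r)  = s≤s (weight-≤ r)
weight-≤ (false ∷ r) = m≤n⇒m≤1+n (weight-≤ r)

weight≡n⇒allOnes : (r : Word n) → weight r ≡ n → r ≡ allOnes n
weight≡n⇒allOnes []                  _  = refl
weight≡n⇒allOnes (true ∷ r)          eq = cong (true ∷_) (weight≡n⇒allOnes r (suc-injective eq))
weight≡n⇒allOnes {suc n} (false ∷ r) eq = contradiction (subst (_≤ n) eq (weight-≤ r)) 1+n≰n

weight-allOnes : ∀ n → weight (allOnes n) ≡ n
weight-allOnes zero    = refl
weight-allOnes (suc n) = cong suc (weight-allOnes n)

weight-∷-cong : ∀ x {u v : Word n} → weight u ≡ weight v → weight (x ∷ u) ≡ weight (x ∷ v)
weight-∷-cong true  eq = cong suc eq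
weight-∷-cong false eq = eq

weight-swap : ∀ x y (u : Word n) → weight (x ∷ y ∷ u) ≡ weight (y ∷ x ∷ u)
weight-swap true  true  _ = refl
weight-swap true  false _ = refl
weight-swap false true  _ = refl
weight-swap false false _ = refl

weight-removeAt : (r : Word (suc n)) (i : Fin (suc n)) → weight (lookup r i ∷ removeAt r i) ≡ weight r
weight-removeAt (x ∷ r)     Fin.zero    = refl
weight-removeAt (x ∷ y ∷ r) (Fin.suc i) =
  trans (weight-swap (lookup (y ∷ r) i) x _) (weight-∷-cong x (weight-removeAt (y ∷ r) i))

count-true : (r : Word n) → Vec.count (true ≟B_) r ≡ weight r
count-true []          = refl
count-true (true ∷ r)  = cong suc (count-true r)
count-true (false ∷ r) = count-true r

count-false : (r : Word n) → Vec.count (false ≟B_) r ≡ n ∸ weight r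
count-false []          = refl
count-false (true ∷ r)  = count-false r
count-false (false ∷ r) = trans (cong suc (count-false r)) (sym (+-∸-assoc 1 (weight-≤ r)))

lookup-removeAt : ∀ {a} {A : Set a} (xs : Vec A (suc n)) i j →
                  lookup (removeAt xs i) j ≡ lookup xs (punchIn i j)
lookup-removeAt xs i j = begin
  lookup (removeAt xs i) j
    ≡⟨ cong (lookup (removeAt xs i)) (punchOut-punchIn i) ⟨
  lookup (removeAt xs i) (Fin.punchOut (punchInᵢ≢i i j ∘ sym))
    ≡⟨ removeAt-punchOut xs _ ⟩
  lookup xs (punchIn i j)
    ∎
  where open ≡-Reasoning

restrictRow-allOnes : (cols : Fin k → Fin ν) → restrictRow cols (allOnes ν) ≡ allOnes k
restrictRow-allOnes {zero}  cols = refl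
restrictRow-allOnes {suc k} cols =
  cong₂ _∷_ (lookup-replicate (cols Fin.zero) true) (restrictRow-allOnes (cols ∘ Fin.suc))

restrictRow-∘ : (cols : Fin k → Fin m) (σ : Fin m → Fin ν) (r : Word ν) →
                restrictRow cols (restrictRow σ r) ≡ restrictRow (σ ∘ cols) r
restrictRow-∘ cols σ r = tabulate-cong (lookup∘tabulate (lookup r ∘ σ) ∘ cols)

restrict-∘ : (cols : Fin k → Fin m) (σ : Fin m → Fin ν) (M : Array ν) →
             restrict cols (restrict σ M) ≡ restrict (σ ∘ cols) M
restrict-∘ cols σ M = trans (sym (map-∘ M)) (map-cong (restrictRow-∘ cols σ) M)

occ-++ : (w : Word n) (xs ys : Array n) → occ w (xs ++ ys) ≡ occ w xs + occ w ys
occ-++ w xs ys = trans (cong length (filter-++ (w ≟W_) xs ys)) (length-++ (filter (w ≟W_) xs))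

occ-↭ : (w : Word n) {xs ys : Array n} → xs ↭ ys → occ w xs ≡ occ w ys
occ-↭ w xs↭ys = ↭-length (filter-↭ (w ≟W_) xs↭ys)

occ-map-injectiveAt : (f : Word m → Word n) {a : Word m} → (∀ x → f x ≡ f a → x ≡ a) →
                      ∀ M → occ (f a) (map f M) ≡ occ a M
occ-map-injectiveAt f     fx≡fa⇒x≡a []      = refl
occ-map-injectiveAt f {a} fx≡fa⇒x≡a (x ∷ M) with f a ≟W f x | a ≟W x
... | yes _     | yes _    = cong suc (occ-map-injectiveAt f fx≡fa⇒x≡a M)
... | no _      | no _     = occ-map-injectiveAt f fx≡fa⇒x≡a M
... | yes fa≡fx | no a≢x   = contradiction (sym (fx≡fa⇒x≡a x (sym fa≡fx))) a≢x
... | no fa≢fx  | yes refl = contradiction refl fa≢fx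

occ-map-≢ : (f : Word m → Word n) {w : Word n} → (∀ x → f x ≢ w) → ∀ M → occ w (map f M) ≡ 0
occ-map-≢ f     fx≢w []      = refl
occ-map-≢ f {w} fx≢w (x ∷ M) with w ≟W f x
... | yes w≡fx = contradiction (sym w≡fx) (fx≢w x)
... | no _     = occ-map-≢ f fx≢w M

occ-∷-concat-tabulate : ∀ b (w : Word n) (r : Word m) (L : Fin m → Array n) {K} →
                        (∀ i → lookup r i ≡ b → occ w (L i) ≡ K) →
                        occ (b ∷ w) (concat (tabulate λ i → map (lookup r i ∷_) (L i)))
                          ≡ Vec.count (b ≟B_) r * K
occ-∷-concat-tabulate b w []      L occ≡K = refl
occ-∷-concat-tabulate b w (x ∷ r) L occ≡K with b ≟B x
... | yes refl = trans (occ-++ (b ∷ w) (map (b ∷_) (L Fin.zero)) _)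
  (cong₂ _+_ (trans (occ-map-injectiveAt (b ∷_) (λ _ → ∷-injectiveʳ) (L Fin.zero)) (occ≡K Fin.zero refl))
             (occ-∷-concat-tabulate b w r (L ∘ Fin.suc) (occ≡K ∘ Fin.suc)))
... | no b≢x   = trans (occ-++ (b ∷ w) (map (x ∷_) (L Fin.zero)) _)
  (cong₂ _+_ (occ-map-≢ (x ∷_) (λ _ eq → b≢x (sym (∷-injectiveˡ eq))) (L Fin.zero))
             (occ-∷-concat-tabulate b w r (L ∘ Fin.suc) (occ≡K ∘ Fin.suc)))

concatMap⁺ : ∀ {a b} {A : Set a} {B : Set b} {f g : A → List B} → (∀ x → f x ↭ g x) →
             ∀ xs → concatMap f xs ↭ concatMap g xs
concatMap⁺ f↭g []       = ↭-refl
concatMap⁺ f↭g (x ∷ xs) = ++⁺ (f↭g x) (concatMap⁺ f↭g xs)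

concatMap-map-∷ : ∀ {a b c} {A : Set a} {B : Set b} {C : Set c} (f : A → B → C) y ys xs →
                  concatMap (λ x → map (f x) (y ∷ ys)) xs
                    ↭ map (λ x → f x y) xs ++ concatMap (λ x → map (f x) ys) xs
concatMap-map-∷ f y ys []       = ↭-refl
concatMap-map-∷ f y ys (x ∷ xs) = ↭-prep (f x y) (↭-trans
  (++⁺ˡ (map (f x) ys) (concatMap-map-∷ f y ys xs))
  (shifts (map (f x) ys) (map (λ x → f x y) xs)))

-- weight-restrictRow follows from injectivity, but is recorded as a field since it is easiest
-- to prove along the construction of permutations.
record ColumnPermutation (n : ℕ) : Set where
  field
    columns            : Fin n → Fin n
    injective          : Injective _≡_ _≡_ columns
    weight-restrictRow : ∀ r → weight (restrictRow columns r) ≡ weight r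

open ColumnPermutation

extend : Fin (suc n) → (Fin n → Fin n) → Fin (suc n) → Fin (suc n)
extend i σ Fin.zero    = i
extend i σ (Fin.suc j) = punchIn i (σ j)

extend-injective : ∀ i {σ : Fin n → Fin n} → Injective _≡_ _≡_ σ → Injective _≡_ _≡_ (extend i σ)
extend-injective i σ-inj {Fin.zero}  {Fin.zero}  _  = refl
extend-injective i σ-inj {Fin.zero}  {Fin.suc y} eq = contradiction (sym eq) (punchInᵢ≢i i _)
extend-injective i σ-inj {Fin.suc x} {Fin.zero}  eq = contradiction eq (punchInᵢ≢i i _)
extend-injective i σ-inj {Fin.suc x} {Fin.suc y} eq = cong Fin.suc (σ-inj (punchIn-injective i _ _ eq))

restrictRow-extend : ∀ i (σ : Fin n → Fin n) (r : Word (suc n)) →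
                     restrictRow (extend i σ) r ≡ lookup r i ∷ restrictRow σ (removeAt r i)
restrictRow-extend i σ r = cong (lookup r i ∷_) (tabulate-cong (sym ∘ lookup-removeAt r i ∘ σ))

insert : Fin (suc n) → ColumnPermutation n → ColumnPermutation (suc n)
insert i π = record
  { columns            = extend i (columns π)
  ; injective          = extend-injective i (injective π)
  ; weight-restrictRow = λ r → begin
      weight (restrictRow (extend i (columns π)) r)
        ≡⟨ cong weight (restrictRow-extend i (columns π) r) ⟩
      weight (lookup r i ∷ restrictRow (columns π) (removeAt r i))
        ≡⟨ weight-∷-cong (lookup r i) (weight-restrictRow π (removeAt r i)) ⟩
      weight (lookup r i ∷ removeAt r i)
        ≡⟨ weight-removeAt r i ⟩
      weight r
        ∎
  }
  where open ≡-Reasoning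

permutations : (n : ℕ) → List (ColumnPermutation n)
permutations zero    =
  [ record { columns = λ () ; injective = λ { {()} } ; weight-restrictRow = λ { [] → refl } } ]
permutations (suc n) = concat (tabulate λ i → map (insert i) (permutations n))

permutations-nonempty : ∀ n → ∃ (_∈ permutations n)
permutations-nonempty zero    = _ , here refl
permutations-nonempty (suc n) with π , π∈ ← permutations-nonempty n =
  insert Fin.zero π , ∈-++⁺ˡ (∈-map⁺ (insert Fin.zero) π∈)

symmetrise : List (ColumnPermutation ν) → Array ν → Array ν
symmetrise P M = concatMap (λ π → restrict (columns π) M) P

orbit : List (ColumnPermutation ν) → Word ν → Array ν
orbit P r = map (λ π → restrictRow (columns π) r) P

∈-symmetrise⁺ : ∀ {P : List (ColumnPermutation ν)} {π M x} → π ∈ P → x ∈ M →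
                restrictRow (columns π) x ∈ symmetrise P M
∈-symmetrise⁺ {π = π} {M} π∈P x∈M =
  ∈-concat⁺′ (∈-map⁺ (restrictRow (columns π)) x∈M) (∈-map⁺ (λ π → restrict (columns π) M) π∈P)

∈-symmetrise⁻ : ∀ (P : List (ColumnPermutation ν)) {M y} → y ∈ symmetrise P M →
                ∃ λ x → x ∈ M × weight y ≡ weight x
∈-symmetrise⁻ P {M} y∈ with _ , y∈xs , xs∈ ← ∈-concat⁻′ (map (λ π → restrict (columns π) M) P) y∈
                        with π , _ , refl ← ∈-map⁻ (λ π → restrict (columns π) M) xs∈
                        with x , x∈M , refl ← ∈-map⁻ (restrictRow (columns π)) y∈xs
  = x , x∈M , weight-restrictRow π x

restrict-symmetrise : (cols : Fin k → Fin ν) (P : List (ColumnPermutation ν)) (M : Array ν) →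
                      restrict cols (symmetrise P M) ≡ concatMap (λ π → restrict (columns π ∘ cols) M) P
restrict-symmetrise cols P M =
  trans (map-concatMap (restrictRow cols) _ P) (concatMap-cong (λ π → restrict-∘ cols (columns π) M) P)

symmetrise-InΔ : ∀ {d} {P : List (ColumnPermutation ν)} {π N D} → π ∈ P →
                 InΔ ν d k N D → InΔ ν d k (symmetrise P N) (symmetrise P D)
symmetrise-InΔ {d = d} {P} {π} {N} {D} π∈P (allOnes∈N , weight≤d , restrict↭) =
  subst (_∈ symmetrise P N) (restrictRow-allOnes (columns π)) (∈-symmetrise⁺ π∈P allOnes∈N) ,
  symmetrised-weight≤d ,
  λ cols cols-inj → subst₂ _↭_ (sym (restrict-symmetrise cols P N)) (sym (restrict-symmetrise cols P D))
    (concatMap⁺ (λ π → restrict↭ (columns π ∘ cols) (cols-inj ∘ injective π)) P)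
  where
  symmetrised-weight≤d : ∀ row → row ∈ symmetrise P D → weight row ≤ d
  symmetrised-weight≤d row row∈ with x , x∈D , eq ← ∈-symmetrise⁻ P row∈ =
    subst (_≤ d) (sym eq) (weight≤d x x∈D)

occ-allOnes-restrict : (π : ColumnPermutation ν) (M : Array ν) →
                       occ (allOnes ν) (restrict (columns π) M) ≡ occ (allOnes ν) M
occ-allOnes-restrict {ν} π M =
  subst (λ w → occ w (restrict (columns π) M) ≡ occ (allOnes ν) M) (restrictRow-allOnes (columns π))
    (occ-map-injectiveAt (restrictRow (columns π)) fibre M)
  where
  open ≡-Reasoning
  fibre : ∀ x → restrictRow (columns π) x ≡ restrictRow (columns π) (allOnes ν) → x ≡ allOnes ν
  fibre x eq = weight≡n⇒allOnes x (begin
    weight x                                     ≡⟨ weight-restrictRow π x ⟨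
    weight (restrictRow (columns π) x)           ≡⟨ cong weight eq ⟩
    weight (restrictRow (columns π) (allOnes ν)) ≡⟨ weight-restrictRow π (allOnes ν) ⟩
    weight (allOnes ν)                           ≡⟨ weight-allOnes ν ⟩
    ν                                            ∎)

occ-allOnes-symmetrise : (P : List (ColumnPermutation ν)) (M : Array ν) →
                         occ (allOnes ν) (symmetrise P M) ≡ length P * occ (allOnes ν) M
occ-allOnes-symmetrise      []      M = refl
occ-allOnes-symmetrise {ν} (π ∷ P) M =
  trans (occ-++ (allOnes ν) (restrict (columns π) M) (symmetrise P M))
        (cong₂ _+_ (occ-allOnes-restrict π M) (occ-allOnes-symmetrise P M))

length-symmetrise : (P : List (ColumnPermutation ν)) (M : Array ν) →
                    length (symmetrise P M) ≡ length P * length M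
length-symmetrise []      M = refl
length-symmetrise (π ∷ P) M =
  trans (length-++ (restrict (columns π) M))
        (cong₂ _+_ (length-map (restrictRow (columns π)) M) (length-symmetrise P M))

symmetrise-[] : (P : List (ColumnPermutation ν)) → symmetrise P [] ≡ []
symmetrise-[] []      = refl
symmetrise-[] (_ ∷ P) = symmetrise-[] P

symmetrise-∷ : (P : List (ColumnPermutation ν)) (r : Word ν) (M : Array ν) →
               symmetrise P (r ∷ M) ↭ orbit P r ++ symmetrise P M
symmetrise-∷ P r M = concatMap-map-∷ (restrictRow ∘ columns) r M P

regular-symmetrise : (P : List (ColumnPermutation ν)) → (∀ r → RegularArray (orbit P r)) →
                     ∀ M → RegularArray (symmetrise P M)
regular-symmetrise P regular-orbit []      w w' _ rewrite symmetrise-[] P = refl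
regular-symmetrise P regular-orbit (r ∷ M) w w' eq = begin
  occ w (symmetrise P (r ∷ M))                 ≡⟨ occ-↭ w (symmetrise-∷ P r M) ⟩
  occ w (orbit P r ++ symmetrise P M)          ≡⟨ occ-++ w (orbit P r) _ ⟩
  occ w (orbit P r) + occ w (symmetrise P M)   ≡⟨ cong₂ _+_ (regular-orbit r w w' eq)
                                                            (regular-symmetrise P regular-orbit M w w' eq) ⟩
  occ w' (orbit P r) + occ w' (symmetrise P M) ≡⟨ occ-++ w' (orbit P r) _ ⟨
  occ w' (orbit P r ++ symmetrise P M)         ≡⟨ occ-↭ w' (symmetrise-∷ P r M) ⟨
  occ w' (symmetrise P (r ∷ M))                ∎
  where open ≡-Reasoning

-- The number of permutations of n columns carrying a given word of weight a to a given word of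
-- weight c.
orbitCount : ℕ → ℕ → ℕ → ℕ
orbitCount n a c = if a ≡ᵇ c then a ! * (n ∸ a) ! else 0

orbitCount-suc-suc : ∀ n a c → a * orbitCount n (pred a) c ≡ orbitCount (suc n) a (suc c)
orbitCount-suc-suc n zero    c = refl
orbitCount-suc-suc n (suc a) c with a ≡ᵇ c
... | true  = sym (*-assoc (suc a) (a !) ((n ∸ a) !))
... | false = *-zeroʳ (suc a)

orbitCount-suc : ∀ n a c → c ≤ n → (suc n ∸ a) * orbitCount n a c ≡ orbitCount (suc n) a c
orbitCount-suc n a c c≤n with a ≡ᵇ c in a≡ᵇc
... | false = *-zeroʳ (suc n ∸ a)
... | true  = begin
  (suc n ∸ a) * (a ! * (n ∸ a) !) ≡⟨ cong (_* (a ! * (n ∸ a) !)) suc-n∸a ⟩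
  suc (n ∸ a) * (a ! * (n ∸ a) !) ≡⟨ x∙yz≈y∙xz *-commutativeSemigroup (suc (n ∸ a)) (a !) _ ⟩
  a ! * suc (n ∸ a) !             ≡⟨ cong (λ m → a ! * m !) suc-n∸a ⟨
  a ! * (suc n ∸ a) !             ∎
  where
  open ≡-Reasoning
  suc-n∸a : suc n ∸ a ≡ suc (n ∸ a)
  suc-n∸a = +-∸-assoc 1 (subst (_≤ n) (sym (≡ᵇ⇒≡ a c (subst T (sym a≡ᵇc) _))) c≤n)

orbit-permutations-suc : (r : Word (suc n)) →
  orbit (permutations (suc n)) r
    ≡ concat (tabulate λ i → map (lookup r i ∷_) (orbit (permutations n) (removeAt r i)))
orbit-permutations-suc {n} r = begin
  map g (concat (tabulate blocks))       ≡⟨ concat-map {f = g} (tabulate blocks) ⟨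
  concat (map (map g) (tabulate blocks)) ≡⟨ cong concat (map-tabulate blocks (map g)) ⟩
  concat (tabulate (map g ∘ blocks))     ≡⟨ cong concat (List.tabulate-cong restrict-block) ⟩
  concat (tabulate λ i → map (lookup r i ∷_) (orbit P (removeAt r i))) ∎
  where
  open ≡-Reasoning
  P : List (ColumnPermutation n)
  P = permutations n
  blocks : Fin (suc n) → List (ColumnPermutation (suc n))
  blocks i = map (insert i) P
  g : ColumnPermutation (suc n) → Word (suc n)
  g π = restrictRow (columns π) r
  restrict-block : ∀ i → map g (blocks i) ≡ map (lookup r i ∷_) (orbit P (removeAt r i))
  restrict-block i = begin
    map g (map (insert i) P)                     ≡⟨ map-∘ P ⟨
    map (g ∘ insert i) P                         ≡⟨ map-cong (λ π → restrictRow-extend i (columns π) r) P ⟩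
    map ((lookup r i ∷_) ∘ (λ π → restrictRow (columns π) (removeAt r i))) P ≡⟨ map-∘ P ⟩
    map (lookup r i ∷_) (orbit P (removeAt r i)) ∎

occ-orbit : ∀ n (r w : Word n) → occ w (orbit (permutations n) r) ≡ orbitCount n (weight r) (weight w)
occ-orbit zero    []  []          = refl
occ-orbit (suc n) r   (true ∷ w)  = begin
  occ (true ∷ w) (orbit (permutations (suc n)) r)
    ≡⟨ cong (occ (true ∷ w)) (orbit-permutations-suc r) ⟩
  occ (true ∷ w) (concat (tabulate λ i → map (lookup r i ∷_) (L i)))
    ≡⟨ occ-∷-concat-tabulate true w r L occ≡K ⟩
  Vec.count (true ≟B_) r * K
    ≡⟨ cong (_* K) (count-true r) ⟩
  weight r * K
    ≡⟨ orbitCount-suc-suc n (weight r) (weight w) ⟩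
  orbitCount (suc n) (weight r) (suc (weight w))
    ∎
  where
  open ≡-Reasoning
  L : Fin (suc n) → Array n
  L i = orbit (permutations n) (removeAt r i)
  K : ℕ
  K = orbitCount n (pred (weight r)) (weight w)
  occ≡K : ∀ i → lookup r i ≡ true → occ w (L i) ≡ K
  occ≡K i rᵢ≡true = trans (occ-orbit n (removeAt r i) w) (cong (λ a → orbitCount n (pred a) (weight w))
    (subst (λ b → weight (b ∷ removeAt r i) ≡ weight r) rᵢ≡true (weight-removeAt r i)))
occ-orbit (suc n) r   (false ∷ w) = begin
  occ (false ∷ w) (orbit (permutations (suc n)) r)
    ≡⟨ cong (occ (false ∷ w)) (orbit-permutations-suc r) ⟩
  occ (false ∷ w) (concat (tabulate λ i → map (lookup r i ∷_) (L i)))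
    ≡⟨ occ-∷-concat-tabulate false w r L occ≡K ⟩
  Vec.count (false ≟B_) r * K
    ≡⟨ cong (_* K) (count-false r) ⟩
  (suc n ∸ weight r) * K
    ≡⟨ orbitCount-suc n (weight r) (weight w) (weight-≤ w) ⟩
  orbitCount (suc n) (weight r) (weight w)
    ∎
  where
  open ≡-Reasoning
  L : Fin (suc n) → Array n
  L i = orbit (permutations n) (removeAt r i)
  K : ℕ
  K = orbitCount n (weight r) (weight w)
  occ≡K : ∀ i → lookup r i ≡ false → occ w (L i) ≡ K
  occ≡K i rᵢ≡false = trans (occ-orbit n (removeAt r i) w) (cong (λ a → orbitCount n a (weight w))
    (subst (λ b → weight (b ∷ removeAt r i) ≡ weight r) rᵢ≡false (weight-removeAt r i)))

regular-orbit : ∀ n (r : Word n) → RegularArray (orbit (permutations n) r)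
regular-orbit n r w w' eq =
  trans (occ-orbit n r w) (trans (cong (orbitCount n (weight r)) eq) (sym (occ-orbit n r w')))

proposition2 : (k d ν : ℕ) → 1 ≤ k → k ≤ d → d ≤ ν →
    (N D : Array ν) → AttainsMax ν d k N D →
    ∃₂ λ (N' D' : Array ν) → InΔ ν d k N' D' × Regular N' D' ×
      (Rstar N' D' * R N D ≡ Rstar N D * R N' D')
proposition2 k d ν _ _ _ N D (N,D∈Δ , _) =
  symmetrise P N , symmetrise P D ,
  symmetrise-InΔ (proj₂ (permutations-nonempty ν)) N,D∈Δ ,
  (regular-symmetrise P (regular-orbit ν) N , regular-symmetrise P (regular-orbit ν) D) ,
  ratio
  where
  open ≡-Reasoning
  P : List (ColumnPermutation ν)
  P = permutations ν
  ratio : occ (allOnes ν) (symmetrise P N) * length D ≡ occ (allOnes ν) N * length (symmetrise P D)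
  ratio = begin
    occ (allOnes ν) (symmetrise P N) * length D ≡⟨ cong (_* length D) (occ-allOnes-symmetrise P N) ⟩
    length P * occ (allOnes ν) N * length D     ≡⟨ xy∙z≈y∙xz *-commutativeSemigroup (length P) _ _ ⟩
    occ (allOnes ν) N * (length P * length D)   ≡⟨ cong (occ (allOnes ν) N *_) (length-symmetrise P D) ⟨
    occ (allOnes ν) N * length (symmetrise P D) ∎
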